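{- Let $C=(a_1,\ldots,a_k\,|\,b_m,\ldots,b_1)$ be a balanced composition with $a_k\neq b_m$. Then $C$ is cyclic if and only if $\mathrm{red}(C)$ is cyclic.
   Context: A composition of $n$ is a tuple of positive integers with sum $n$. The reverse layered permutation associated to a composition $(c_1,\ldots,c_r)$ of $n$ is, in one-line notation, $(n-c_1+1)\cdots(n)\,(n-c_1-c_2+1)\cdots(n-c_1)\cdots(1)\cdots(c_r)$: the values are split into consecutive blocks of sizes $c_1,\ldots,c_r$, the blocks appear in decreasing order of values, each block increasing. The composition is cyclic if this permutation is a single $n$-cycle. The notation $(a_1,\ldots,a_k\,|\,b_m,\ldots,b_1)$ denotes the composition $(a_1,\ldots,a_k,b_m,\ldots,b_1)$ of $n$ with $a_1+\cdots+a_k=b_1+\cdots+b_m=n/2$ (a balanced composition). For such $C$ with $a_k\neq b_m$, let $D=|a_k-b_m|$, $u=a_k \bmod D\in\{0,\ldots,D-1\}$ and $v=D-u$. If $a_k>b_m$, $\mathrm{red}(C)=(a_1,\ldots,a_{k-1},u,v\,|\,b_{m-1},\ldots,b_1)$; if $a_k<b_m$, $\mathrm{red}(C)=(a_1,\ldots,a_{k-1}\,|\,v,u,b_{m-1},\ldots,b_1)$; in both cases $u$ is omitted from the composition if $u=0$. ($\mathrm{red}(C)$ is again a balanced composition, of a smaller integer.) -}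

module Defs where

open import Data.Nat using (ℕ; zero; suc; _+_; _∸_; _≤_; _<_; compare; less; equal; greater)
open import Data.Nat.DivMod using (_%_)
open import Data.List using (List; []; _∷_; _++_; map; upTo)
open import Data.Nat.ListAction using (sum)
open import Data.Product using (∃)
open import Function using (_∘_)
open import Relation.Binary.PropositionalEquality using (_≡_)

-- A composition is a list of positive naturals (positivity imposed in the statement).

-- One-line notation of the reverse layered permutation of a composition (c₁,…,cᵣ) of n:
-- first block (n-c₁+1)…n, then (n-c₁-c₂+1)…(n-c₁), …, last block 1…cᵣ.
oneLineFrom : ℕ → List ℕ → List ℕ
oneLineFrom n []       = []
oneLineFrom n (c ∷ cs) = map (λ i → suc (n ∸ c + i)) (upTo c) ++ oneLineFrom (n ∸ c) cs

oneLine : List ℕ → List ℕ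
oneLine cs = oneLineFrom (sum cs) cs

-- list indexing with default 0 (0-based position)
nth : List ℕ → ℕ → ℕ
nth []       _       = 0
nth (x ∷ xs) zero    = x
nth (x ∷ xs) (suc i) = nth xs i

rlp : List ℕ → ℕ → ℕ
rlp cs x = nth (oneLine cs) (x ∸ 1)

iter : (ℕ → ℕ) → ℕ → ℕ → ℕ
iter f zero    x = x
iter f (suc j) x = f (iter f j x)

-- cyclic: the permutation is a single n-cycle, i.e. the σ-orbit of 1 is all of {1,…,n}
Cyclic : List ℕ → Set
Cyclic cs = ∀ x → 1 ≤ x → x ≤ sum cs → ∃ λ j → iter (rlp cs) j 1 ≡ x

opt : ℕ → List ℕ
opt zero    = []
opt (suc u) = suc u ∷ []

-- red of the balanced composition (A' , aₖ | bₘ , B'), represented as the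
-- composition A' ++ aₖ ∷ bₘ ∷ B'  where A' = (a₁,…,a_{k-1}) and B' = (b_{m-1},…,b₁).
-- D = |aₖ - bₘ|, u = aₖ mod D, v = D - u.
red : List ℕ → ℕ → ℕ → List ℕ → List ℕ
red A' ak bm B' with compare ak bm
-- aₖ < bₘ : bₘ = suc (aₖ + d), D = suc d
... | less .ak d    = A' ++ (suc d ∸ (ak % suc d)) ∷ opt (ak % suc d) ++ B'
-- aₖ = bₘ : excluded by hypothesis; arbitrary value
... | equal .ak     = A' ++ ak ∷ bm ∷ B'
-- aₖ > bₘ : aₖ = suc (bₘ + d), D = suc d
... | greater .bm d = A' ++ opt (ak % suc d) ++ (suc d ∸ (ak % suc d)) ∷ B'

module Submission where

-- The heart is the module Greater
-- (aₖ > bₘ): the old permutation climbs block aₖ in steps of D = aₖ - bₘ before leaving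
-- it, which the reduced composition does in a single step; a projection τ and an
-- embedding ρ between the two sets of places give both implications via covers-transfer.
-- The case aₖ < bₘ is reduced to it by reversing the composition.

open import Defs
open import Data.Nat using (ℕ; _+_; _<_)
open import Data.List using (List; _∷_; _++_)
open import Data.Nat.ListAction using (sum)
open import Data.List.Relation.Unary.All using (All)
open import Function.Bundles using (_⇔_)
open import Relation.Binary.PropositionalEquality using (_≡_; _≢_)

open import Data.Nat using (zero; suc; pred; _*_; _∸_; _≤_; _≤?_; z≤n; s≤s; NonZero; compare; less; equal; greater)
open import Data.Nat.Properties
open import Data.Nat.DivMod using (_%_; _/_; %-distribˡ-+; m%n%n≡m%n; [m+n]%n≡m%n; [m+kn]%n≡m%n; m<n⇒m%n≡m; m%n<n; m≡m%n+[m/n]*n)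
open import Data.Nat.Tactic.RingSolver using (solve; solve-∀)
open import Data.Nat.ListAction.Properties using (sum-++; sum-↭)
open import Data.List using ([]; [_]; map; upTo; applyUpTo; length; reverse)
open import Data.List.Properties using (length-map; length-applyUpTo; ++-assoc; reverse-++; reverse-involutive; unfold-reverse)
open import Data.List.Relation.Binary.Permutation.Propositional.Properties using (↭-reverse)
open import Data.Product using (∃; _×_; _,_; proj₁; proj₂; uncurry)
open import Function using (_∘_; id)
open import Function.Bundles using (mk⇔)
open import Function.Construct.Symmetry using (⇔-sym)
open import Function.Construct.Composition using (_⇔-∘_)
open import Function.Properties.Equivalence using (⇔-setoid)
open import Level using (0ℓ)
open import Relation.Nullary using (yes; no; contradiction)
open import Relation.Binary.PropositionalEquality using (refl; sym; trans; cong; cong₂; subst; subst₂; module ≡-Reasoning)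
import Relation.Binary.Reasoning.Setoid as SetoidReasoning

iter-+ : ∀ f j k x → iter f (j + k) x ≡ iter f j (iter f k x)
iter-+ f zero    k x = refl
iter-+ f (suc j) k x = cong f (iter-+ f j k x)

iter-swap : ∀ f j x → iter f j (f x) ≡ f (iter f j x)
iter-swap f zero    x = refl
iter-swap f (suc j) x = cong f (iter-swap f j x)

Reach : (ℕ → ℕ) → ℕ → ℕ → Set
Reach f x y = ∃ λ j → iter f j x ≡ y

reach-≡ : ∀ {f x y} → x ≡ y → Reach f x y
reach-≡ refl = 0 , refl

reach-step : ∀ {f x y} → f x ≡ y → Reach f x y
reach-step refl = 1 , refl

reach-trans : ∀ {f x y z} → Reach f x y → Reach f y z → Reach f x z
reach-trans {f} {x} (j , refl) (k , refl) = k + j , iter-+ f k j x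

MapsInto : (ℕ → ℕ) → ℕ → Set
MapsInto f n = ∀ x → 1 ≤ x → x ≤ n → 1 ≤ f x × f x ≤ n

-- the orbit of 1 meets every point of {1,…,n};  Cyclic cs  is  Covers (rlp cs) (sum cs)
Covers : (ℕ → ℕ) → ℕ → Set
Covers f n = ∀ x → 1 ≤ x → x ≤ n → Reach f 1 x

iter-mapsInto : ∀ {f n} → MapsInto f n → ∀ k x → 1 ≤ x → x ≤ n → 1 ≤ iter f k x × iter f k x ≤ n
iter-mapsInto into zero    x 1≤x x≤n = 1≤x , x≤n
iter-mapsInto into (suc k) x 1≤x x≤n with iter-mapsInto into k x 1≤x x≤n
... | 1≤y , y≤n = into _ 1≤y y≤n

covers-transfer : ∀ (f g τ : ℕ → ℕ) n m → MapsInto f n → τ 1 ≡ 1 →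
  (∀ x → 1 ≤ x → x ≤ n → Reach g (τ x) (τ (f x))) →
  (∀ z → 1 ≤ z → z ≤ m → ∃ λ y → 1 ≤ y × y ≤ n × Reach g (τ y) z) →
  Covers f n → Covers g m
covers-transfer f g τ n m into τ1 step onto cov z 1≤z z≤m with onto z 1≤z z≤m
... | y , 1≤y , y≤n , y⇝z with cov y 1≤y y≤n
... | k , refl = reach-trans (along k) y⇝z
  where
    along : ∀ k → Reach g 1 (τ (iter f k 1))
    along zero    = reach-≡ (sym τ1)
    along (suc k) with iter-mapsInto into k 1 ≤-refl (≤-trans 1≤y y≤n)
    ... | 1≤x , x≤n = reach-trans (along k) (step _ 1≤x x≤n)

iter-cancel : ∀ {f g n} → MapsInto f n → (∀ x → 1 ≤ x → x ≤ n → g (f x) ≡ x) →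
  ∀ r x → 1 ≤ x → x ≤ n → iter g r (iter f r x) ≡ x
iter-cancel into gf zero    x 1≤x x≤n = refl
iter-cancel {f} {g} into gf (suc r) x 1≤x x≤n with into x 1≤x x≤n
... | 1≤fx , fx≤n = begin
  g (iter g r (f (iter f r x))) ≡⟨ cong (g ∘ iter g r) (sym (iter-swap f r x)) ⟩
  g (iter g r (iter f r (f x))) ≡⟨ cong g (iter-cancel into gf r (f x) 1≤fx fx≤n) ⟩
  g (f x)                       ≡⟨ gf x 1≤x x≤n ⟩
  x                             ∎
  where open ≡-Reasoning

iter-period : ∀ f P x k → iter f P x ≡ x → iter f (k * P) x ≡ x
iter-period f P x zero    fix = refl
iter-period f P x (suc k) fix = begin
  iter f (P + k * P) x        ≡⟨ iter-+ f P (k * P) x ⟩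
  iter f P (iter f (k * P) x) ≡⟨ cong (iter f P) (iter-period f P x k fix) ⟩
  iter f P x                  ≡⟨ fix ⟩
  x                           ∎
  where open ≡-Reasoning

covers-returns : ∀ {f g n} → MapsInto g n → (∀ x → 1 ≤ x → x ≤ n → f (g x) ≡ x) →
  Covers f n → 1 ≤ n → ∃ λ i → iter f (suc i) 1 ≡ 1
covers-returns {f} {g} intoG fg cov 1≤n with intoG 1 ≤-refl 1≤n
... | 1≤g1 , g1≤n with cov (g 1) 1≤g1 g1≤n
... | i , fⁱ1≡g1 = i , trans (cong f fⁱ1≡g1) (fg 1 ≤-refl 1≤n)

-- The inverse of a permutation of {1,…,n} whose orbit of 1 covers {1,…,n} covers too:
-- from x = fʲ(1) and f^(1+i)(1) = 1 we get g^(i·j)(1) = g^(i·j)(f^(i·j+j)(1)) = fʲ(1) = x.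
covers-inverse : ∀ (f g : ℕ → ℕ) n → MapsInto f n → MapsInto g n →
  (∀ x → 1 ≤ x → x ≤ n → g (f x) ≡ x) → (∀ x → 1 ≤ x → x ≤ n → f (g x) ≡ x) →
  Covers f n → Covers g n
covers-inverse f g n intoF intoG gf fg cov x 1≤x x≤n =
  invert (covers-returns intoG fg cov (≤-trans 1≤x x≤n)) (cov x 1≤x x≤n)
  where
    open ≡-Reasoning
    invert : (∃ λ i → iter f (suc i) 1 ≡ 1) → Reach f 1 x → Reach g 1 x
    invert (i , period) (j , fʲ1≡x) = i * j , (begin
      iter g (i * j) 1                             ≡⟨ cong (iter g (i * j)) (sym (iter-period f (suc i) 1 j period)) ⟩
      iter g (i * j) (iter f (j * suc i) 1)        ≡⟨ cong (λ t → iter g (i * j) (iter f t 1)) j·[1+i]≡i·j+j ⟩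
      iter g (i * j) (iter f (i * j + j) 1)        ≡⟨ cong (iter g (i * j)) (iter-+ f (i * j) j 1) ⟩
      iter g (i * j) (iter f (i * j) (iter f j 1)) ≡⟨ iter-cancel intoF gf (i * j) _ 1≤fʲ1 fʲ1≤n ⟩
      iter f j 1                                   ≡⟨ fʲ1≡x ⟩
      x                                            ∎)
      where
        j·[1+i]≡i·j+j : j * suc i ≡ i * j + j
        j·[1+i]≡i·j+j = trans (*-comm j (suc i)) (+-comm j (i * j))
        1≤fʲ1 : 1 ≤ iter f j 1
        1≤fʲ1 = subst (1 ≤_) (sym fʲ1≡x) 1≤x
        fʲ1≤n : iter f j 1 ≤ n
        fʲ1≤n = subst (_≤ n) (sym fʲ1≡x) x≤n

data Split (L : ℕ) : ℕ → Set where
  before : ∀ {p} → p < L → Split L (suc p)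
  after  : ∀ {y} → 1 ≤ y → Split L (L + y)

split : ∀ L x → 1 ≤ x → Split L x
split zero    (suc x)       _ = after (s≤s z≤n)
split (suc L) (suc zero)    _ = before (s≤s z≤n)
split (suc L) (suc (suc x)) _ = shift (split L (suc x) (s≤s z≤n))
  where
    shift : ∀ {x} → Split L x → Split (suc L) (suc x)
    shift (before p<L) = before (s≤s p<L)
    shift (after 1≤y)  = after 1≤y

nth-++ˡ : ∀ xs ys i → i < length xs → nth (xs ++ ys) i ≡ nth xs i
nth-++ˡ (x ∷ xs) ys zero    _         = refl
nth-++ˡ (x ∷ xs) ys (suc i) (s≤s i<l) = nth-++ˡ xs ys i i<l

nth-++ʳ : ∀ xs ys i → nth (xs ++ ys) (length xs + i) ≡ nth ys i
nth-++ʳ []       ys i = refl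
nth-++ʳ (x ∷ xs) ys i = nth-++ʳ xs ys i

nth-map-applyUpTo : ∀ (f g : ℕ → ℕ) c i → i < c → nth (map f (applyUpTo g c)) i ≡ f (g i)
nth-map-applyUpTo f g (suc c) zero    _         = refl
nth-map-applyUpTo f g (suc c) (suc i) (s≤s i<c) = nth-map-applyUpTo f (g ∘ suc) c i i<c

length-block : ∀ (f : ℕ → ℕ) c → length (map f (upTo c)) ≡ c
length-block f c = trans (length-map f (upTo c)) (length-applyUpTo id c)

oneLineFrom-head : ∀ n c cs i → i < c → nth (oneLineFrom n (c ∷ cs)) i ≡ suc (n ∸ c + i)
oneLineFrom-head n c cs i i<c = begin
  nth (block ++ oneLineFrom (n ∸ c) cs) i ≡⟨ nth-++ˡ block _ i (subst (i <_) (sym (length-block _ c)) i<c) ⟩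
  nth block i                             ≡⟨ nth-map-applyUpTo _ id c i i<c ⟩
  suc (n ∸ c + i)                         ∎
  where
    open ≡-Reasoning
    block : List ℕ
    block = map (λ j → suc (n ∸ c + j)) (upTo c)

oneLineFrom-tail : ∀ n c cs i → nth (oneLineFrom n (c ∷ cs)) (c + i) ≡ nth (oneLineFrom (n ∸ c) cs) i
oneLineFrom-tail n c cs i = begin
  nth (block ++ rest) (c + i)            ≡⟨ cong (λ l → nth (block ++ rest) (l + i)) (sym (length-block _ c)) ⟩
  nth (block ++ rest) (length block + i) ≡⟨ nth-++ʳ block rest i ⟩
  nth rest i                             ∎
  where
    open ≡-Reasoning
    block rest : List ℕ
    block = map (λ j → suc (n ∸ c + j)) (upTo c)
    rest  = oneLineFrom (n ∸ c) cs

rlp-head : ∀ c cs x → 1 ≤ x → x ≤ c → rlp (c ∷ cs) x ≡ sum cs + x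
rlp-head c cs (suc i) _ i<c = begin
  nth (oneLineFrom (c + sum cs) (c ∷ cs)) i ≡⟨ oneLineFrom-head (c + sum cs) c cs i i<c ⟩
  suc (c + sum cs ∸ c + i)                  ≡⟨ cong (λ t → suc (t + i)) (m+n∸m≡n c (sum cs)) ⟩
  suc (sum cs + i)                          ≡⟨ sym (+-suc (sum cs) i) ⟩
  sum cs + suc i                            ∎
  where open ≡-Reasoning

rlp-tail : ∀ c cs y → 1 ≤ y → rlp (c ∷ cs) (c + y) ≡ rlp cs y
rlp-tail c cs (suc i) _ = begin
  nth (oneLineFrom (c + sum cs) (c ∷ cs)) (c + suc i ∸ 1) ≡⟨ cong (nth (oneLineFrom (c + sum cs) (c ∷ cs)) ∘ (_∸ 1)) (+-suc c i) ⟩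
  nth (oneLineFrom (c + sum cs) (c ∷ cs)) (c + i)         ≡⟨ oneLineFrom-tail (c + sum cs) c cs i ⟩
  nth (oneLineFrom (c + sum cs ∸ c) cs) i                 ≡⟨ cong (λ t → nth (oneLineFrom t cs) i) (m+n∸m≡n c (sum cs)) ⟩
  nth (oneLineFrom (sum cs) cs) i                         ∎
  where open ≡-Reasoning

rlp-++ˡ : ∀ A R x → 1 ≤ x → x ≤ sum A → rlp (A ++ R) x ≡ sum R + rlp A x
rlp-++ˡ []      R (suc x) _ ()
rlp-++ˡ (c ∷ A) R x 1≤x x≤ with split c x 1≤x
... | before x≤c = begin
  rlp (c ∷ (A ++ R)) x  ≡⟨ rlp-head c (A ++ R) x 1≤x x≤c ⟩
  sum (A ++ R) + x      ≡⟨ cong (_+ x) (trans (sum-++ A R) (+-comm (sum A) (sum R))) ⟩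
  sum R + sum A + x     ≡⟨ +-assoc (sum R) (sum A) x ⟩
  sum R + (sum A + x)   ≡⟨ cong (sum R +_) (sym (rlp-head c A x 1≤x x≤c)) ⟩
  sum R + rlp (c ∷ A) x ∎
  where open ≡-Reasoning
... | after {y} 1≤y = begin
  rlp (c ∷ (A ++ R)) (c + y)  ≡⟨ rlp-tail c (A ++ R) y 1≤y ⟩
  rlp (A ++ R) y              ≡⟨ rlp-++ˡ A R y 1≤y (+-cancelˡ-≤ c y (sum A) x≤) ⟩
  sum R + rlp A y             ≡⟨ cong (sum R +_) (sym (rlp-tail c A y 1≤y)) ⟩
  sum R + rlp (c ∷ A) (c + y) ∎
  where open ≡-Reasoning

rlp-++ʳ : ∀ A R y → 1 ≤ y → rlp (A ++ R) (sum A + y) ≡ rlp R y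
rlp-++ʳ []      R y 1≤y = refl
rlp-++ʳ (c ∷ A) R y 1≤y = begin
  rlp (c ∷ (A ++ R)) (c + sum A + y)   ≡⟨ cong (rlp (c ∷ (A ++ R))) (+-assoc c (sum A) y) ⟩
  rlp (c ∷ (A ++ R)) (c + (sum A + y)) ≡⟨ rlp-tail c (A ++ R) (sum A + y) (≤-trans 1≤y (m≤n+m y (sum A))) ⟩
  rlp (A ++ R) (sum A + y)             ≡⟨ rlp-++ʳ A R y 1≤y ⟩
  rlp R y                              ∎
  where open ≡-Reasoning

rlp-mapsInto : ∀ cs → MapsInto (rlp cs) (sum cs)
rlp-mapsInto []       (suc x) _ ()
rlp-mapsInto (c ∷ cs) x 1≤x x≤ with split c x 1≤x
... | before x≤c rewrite rlp-head c cs x 1≤x x≤c =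
  ≤-trans 1≤x (m≤n+m x (sum cs)) , subst (_≤ c + sum cs) (+-comm x (sum cs)) (+-monoˡ-≤ (sum cs) x≤c)
... | after {y} 1≤y rewrite rlp-tail c cs y 1≤y with rlp-mapsInto cs y 1≤y (+-cancelˡ-≤ c y (sum cs) x≤)
... | 1≤σy , σy≤ = 1≤σy , ≤-trans σy≤ (m≤n+m (sum cs) c)

sum-reverse : ∀ cs → sum (reverse cs) ≡ sum cs
sum-reverse cs = sum-↭ (↭-reverse cs)

rlp-reverse : ∀ cs x → 1 ≤ x → x ≤ sum cs → rlp (reverse cs) (rlp cs x) ≡ x
rlp-reverse []       (suc x) _ ()
rlp-reverse (c ∷ cs) x 1≤x x≤ with split c x 1≤x
... | before x≤c = begin
  rlp (reverse (c ∷ cs)) (rlp (c ∷ cs) x)  ≡⟨ cong₂ rlp (unfold-reverse c cs) (rlp-head c cs x 1≤x x≤c) ⟩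
  rlp (reverse cs ++ [ c ]) (sum cs + x)   ≡⟨ cong (λ t → rlp (reverse cs ++ [ c ]) (t + x)) (sym (sum-reverse cs)) ⟩
  rlp (reverse cs ++ [ c ]) (sum (reverse cs) + x) ≡⟨ rlp-++ʳ (reverse cs) [ c ] x 1≤x ⟩
  rlp [ c ] x                              ≡⟨ rlp-head c [] x 1≤x x≤c ⟩
  x                                        ∎
  where open ≡-Reasoning
... | after {y} 1≤y with rlp-mapsInto cs y 1≤y (+-cancelˡ-≤ c y (sum cs) x≤)
... | 1≤σy , σy≤ = begin
  rlp (reverse (c ∷ cs)) (rlp (c ∷ cs) (c + y)) ≡⟨ cong₂ rlp (unfold-reverse c cs) (rlp-tail c cs y 1≤y) ⟩
  rlp (reverse cs ++ [ c ]) (rlp cs y)          ≡⟨ rlp-++ˡ (reverse cs) [ c ] (rlp cs y) 1≤σy (subst (rlp cs y ≤_) (sym (sum-reverse cs)) σy≤) ⟩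
  (c + 0) + rlp (reverse cs) (rlp cs y)         ≡⟨ cong₂ _+_ (+-identityʳ c) (rlp-reverse cs y 1≤y (+-cancelˡ-≤ c y (sum cs) x≤)) ⟩
  c + y                                         ∎
  where open ≡-Reasoning

-- A composition is cyclic iff its reverse is: the two permutations are mutually inverse.
cyclic-reverse : ∀ cs → Cyclic cs → Cyclic (reverse cs)
cyclic-reverse cs cyc =
  subst (Covers (rlp (reverse cs))) (sym (sum-reverse cs))
    (covers-inverse (rlp cs) (rlp (reverse cs)) (sum cs) (rlp-mapsInto cs) reverse-into (rlp-reverse cs) rlp-reverse′ cyc)
  where
    reverse-into : MapsInto (rlp (reverse cs)) (sum cs)
    reverse-into = subst (MapsInto (rlp (reverse cs))) (sum-reverse cs) (rlp-mapsInto (reverse cs))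
    rlp-reverse′ : ∀ x → 1 ≤ x → x ≤ sum cs → rlp cs (rlp (reverse cs) x) ≡ x
    rlp-reverse′ x 1≤x x≤ =
      subst (λ l → rlp l (rlp (reverse cs) x) ≡ x) (reverse-involutive cs)
        (rlp-reverse (reverse cs) x 1≤x (subst (x ≤_) (sym (sum-reverse cs)) x≤))

cyclic⇔cyclic-reverse : ∀ cs → Cyclic cs ⇔ Cyclic (reverse cs)
cyclic⇔cyclic-reverse cs =
  mk⇔ (cyclic-reverse cs) (subst Cyclic (reverse-involutive cs) ∘ cyclic-reverse (reverse cs))

cyclic-cong : ∀ cs cs′ → sum cs ≡ sum cs′ → (∀ n → oneLineFrom n cs ≡ oneLineFrom n cs′) →
  Cyclic cs → Cyclic cs′
cyclic-cong cs cs′ sum≡ line≡ =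
  subst₂ (λ l n → Covers (λ x → nth l (x ∸ 1)) n) (trans (line≡ (sum cs)) (cong (λ n → oneLineFrom n cs′) sum≡)) sum≡

oneLineFrom-opt : ∀ n A u R → oneLineFrom n (A ++ opt u ++ R) ≡ oneLineFrom n (A ++ u ∷ R)
oneLineFrom-opt n []      zero    R = refl
oneLineFrom-opt n []      (suc u) R = refl
oneLineFrom-opt n (c ∷ A) u       R = cong (map (λ i → suc (n ∸ c + i)) (upTo c) ++_) (oneLineFrom-opt (n ∸ c) A u R)

sum-opt : ∀ A u R → sum (A ++ opt u ++ R) ≡ sum (A ++ u ∷ R)
sum-opt []      zero    R = refl
sum-opt []      (suc u) R = refl
sum-opt (c ∷ A) u       R = cong (c +_) (sum-opt A u R)

cyclic-opt : ∀ A u R → Cyclic (A ++ opt u ++ R) ⇔ Cyclic (A ++ u ∷ R)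
cyclic-opt A u R =
  mk⇔ (cyclic-cong (A ++ opt u ++ R) (A ++ u ∷ R) (sum-opt A u R) (λ n → oneLineFrom-opt n A u R))
      (cyclic-cong (A ++ u ∷ R) (A ++ opt u ++ R) (sym (sum-opt A u R)) (λ n → sym (oneLineFrom-opt n A u R)))

[m%d+n]%d≡[m+n]%d : ∀ m n d .{{_ : NonZero d}} → (m % d + n) % d ≡ (m + n) % d
[m%d+n]%d≡[m+n]%d m n d = begin
  (m % d + n) % d         ≡⟨ %-distribˡ-+ (m % d) n d ⟩
  (m % d % d + n % d) % d ≡⟨ cong (λ t → (t + n % d) % d) (m%n%n≡m%n m d) ⟩
  (m % d + n % d) % d     ≡⟨ %-distribˡ-+ m n d ⟨
  (m + n) % d             ∎
  where open ≡-Reasoning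

[m+n%d]%d≡[m+n]%d : ∀ m n d .{{_ : NonZero d}} → (m + n % d) % d ≡ (m + n) % d
[m+n%d]%d≡[m+n]%d m n d = begin
  (m + n % d) % d ≡⟨ cong (_% d) (+-comm m (n % d)) ⟩
  (n % d + m) % d ≡⟨ [m%d+n]%d≡[m+n]%d n m d ⟩
  (n + m) % d     ≡⟨ cong (_% d) (+-comm n m) ⟩
  (m + n) % d     ∎
  where open ≡-Reasoning

module Opposite {d} .{{_ : NonZero d}} (b v k : ℕ) (b+v≡kd : b + v ≡ k * d) where

  cancels : ∀ r → (r + (b + v)) % d ≡ r % d
  cancels r = trans (cong (λ t → (r + t) % d) b+v≡kd) ([m+kn]%n≡m%n r k d)

  [[b+r]%d+v]%d≡r%d : ∀ r → ((b + r) % d + v) % d ≡ r % d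
  [[b+r]%d+v]%d≡r%d r = begin
    ((b + r) % d + v) % d ≡⟨ [m%d+n]%d≡[m+n]%d (b + r) v d ⟩
    (b + r + v) % d       ≡⟨ cong (_% d) (solve (b ∷ r ∷ v ∷ [])) ⟩
    (r + (b + v)) % d     ≡⟨ cancels r ⟩
    r % d                 ∎
    where open ≡-Reasoning

  [b+[r+v]%d]%d≡r%d : ∀ r → (b + (r + v) % d) % d ≡ r % d
  [b+[r+v]%d]%d≡r%d r = begin
    (b + (r + v) % d) % d ≡⟨ [m+n%d]%d≡[m+n]%d b (r + v) d ⟩
    (b + (r + v)) % d     ≡⟨ cong (_% d) (solve (b ∷ r ∷ v ∷ [])) ⟩
    (r + (b + v)) % d     ≡⟨ cancels r ⟩
    r % d                 ∎
    where open ≡-Reasoning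

+-exchange : ∀ x y z → x + (y + z) ≡ y + (x + z)
+-exchange = solve-∀

+-exchangeʳ : ∀ x y z → x + y + z ≡ x + z + y
+-exchangeʳ = solve-∀

glue : ℕ → (ℕ → ℕ) → (ℕ → ℕ) → ℕ → ℕ
glue L h k x with x ≤? L
... | yes _ = h x
... | no  _ = k (x ∸ L)

glue-≤ : ∀ L h k x → x ≤ L → glue L h k x ≡ h x
glue-≤ L h k x x≤L with x ≤? L
... | yes _   = refl
... | no  x≰L = contradiction x≤L x≰L

glue-+ : ∀ L h k y → 1 ≤ y → glue L h k (L + y) ≡ k y
glue-+ L h k y 1≤y with L + y ≤? L
... | yes L+y≤L = contradiction L+y≤L (<⇒≱ (m<m+n L 1≤y))
... | no  _     = cong k (m+n∸m≡n L y)

data Below (b : ℕ) : ℕ → Set where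
  below : ∀ {p} → p < b → Below b p
  above : ∀ r → Below b (b + r)

below? : ∀ b p → Below b p
below? zero    p       = above p
below? (suc b) zero    = below (s≤s z≤n)
below? (suc b) (suc p) with below? b p
... | below p<b = below (s≤s p<b)
... | above r   = above r

module TwoBlocks (A : List ℕ) (c₁ c₂ : ℕ) (B : List ℕ) where

  σ : ℕ → ℕ
  σ = rlp (A ++ c₁ ∷ c₂ ∷ B)

  on-A : ∀ x → 1 ≤ x → x ≤ sum A → σ x ≡ c₁ + (c₂ + sum B) + rlp A x
  on-A = rlp-++ˡ A (c₁ ∷ c₂ ∷ B)

  on-c₁ : ∀ p → p < c₁ → σ (sum A + suc p) ≡ c₂ + sum B + suc p
  on-c₁ p p<c₁ = trans (rlp-++ʳ A _ (suc p) (s≤s z≤n)) (rlp-head c₁ (c₂ ∷ B) (suc p) (s≤s z≤n) p<c₁)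

  on-c₂ : ∀ p → p < c₂ → σ (sum A + (c₁ + suc p)) ≡ sum B + suc p
  on-c₂ p p<c₂ = begin
    σ (sum A + (c₁ + suc p))       ≡⟨ rlp-++ʳ A _ (c₁ + suc p) (m≤n⇒m≤o+n c₁ (s≤s z≤n)) ⟩
    rlp (c₁ ∷ c₂ ∷ B) (c₁ + suc p) ≡⟨ rlp-tail c₁ (c₂ ∷ B) (suc p) (s≤s z≤n) ⟩
    rlp (c₂ ∷ B) (suc p)           ≡⟨ rlp-head c₂ B (suc p) (s≤s z≤n) p<c₂ ⟩
    sum B + suc p                  ∎
    where open ≡-Reasoning

  on-B : ∀ y → 1 ≤ y → σ (sum A + (c₁ + (c₂ + y))) ≡ rlp B y
  on-B y 1≤y = begin
    σ (sum A + (c₁ + (c₂ + y)))       ≡⟨ rlp-++ʳ A _ (c₁ + (c₂ + y)) (m≤n⇒m≤o+n c₁ (m≤n⇒m≤o+n c₂ 1≤y)) ⟩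
    rlp (c₁ ∷ c₂ ∷ B) (c₁ + (c₂ + y)) ≡⟨ rlp-tail c₁ (c₂ ∷ B) (c₂ + y) (m≤n⇒m≤o+n c₂ 1≤y) ⟩
    rlp (c₂ ∷ B) (c₂ + y)             ≡⟨ rlp-tail c₂ B y 1≤y ⟩
    rlp B y                           ∎
    where open ≡-Reasoning

-- With D = aₖ - bₘ, N = sum A and M = sum B, balance says M = N + D.
-- Old places: A | block a (length b + D) | block b | B;  new places: A | u | v | B,
-- where u + v = D.  The old permutation moves block a onto block b (or, for its last D
-- places, onto the first places of B), and block b onto block a shifted by D; so a point
-- entering block a at place q < D climbs q, q + D, q + 2D, … and leaves at the unique
-- place b + e with e ≡ q - b (mod D).  The new permutation sends middle place q directly
-- to B-place 1 + e with e = (q + v) mod D, and v ≡ -b (mod D).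
module Greater (A B : List ℕ) (a b d : ℕ) (a≡b+D : a ≡ b + suc d) (balanced : sum A + a ≡ b + sum B) where

  D N M u v : ℕ
  D = suc d
  N = sum A
  M = sum B
  u = a % D
  v = D ∸ u

  old new : List ℕ
  old = A ++ a ∷ b ∷ B
  new = A ++ u ∷ v ∷ B

  f g : ℕ → ℕ
  f = rlp old
  g = rlp new

  M≡N+D : M ≡ N + D
  M≡N+D = +-cancelˡ-≡ b M (N + D) (trans (sym balanced) (trans (cong (N +_) a≡b+D) (+-exchange N b D)))

  u<D : u < D
  u<D = m%n<n a D

  u+v≡D : u + v ≡ D
  u+v≡D = m+[n∸m]≡n (<⇒≤ u<D)

  -- v is the residue of -b: b + v is a multiple of D
  b+v≡kD : b + v ≡ suc (b / D) * D
  b+v≡kD = begin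
    b + v                       ≡⟨ cong (_+ v) (m≡m%n+[m/n]*n b D) ⟩
    b % D + (b / D) * D + v     ≡⟨ cong (λ t → t + (b / D) * D + v) (sym u≡b%D) ⟩
    u + (b / D) * D + v         ≡⟨ +-exchangeʳ u ((b / D) * D) v ⟩
    (u + v) + (b / D) * D       ≡⟨ cong (_+ (b / D) * D) u+v≡D ⟩
    D + (b / D) * D             ∎
    where
      open ≡-Reasoning
      u≡b%D : u ≡ b % D
      u≡b%D = trans (cong (_% D) a≡b+D) ([m+n]%n≡m%n b D)

  open Opposite b v (suc (b / D)) b+v≡kD

  sum-old : sum old ≡ N + (a + (b + M))
  sum-old = sum-++ A (a ∷ b ∷ B)

  sum-new : sum new ≡ N + (D + M)
  sum-new = trans (sum-++ A (u ∷ v ∷ B)) (cong (N +_) (trans (sym (+-assoc u v M)) (cong (_+ M) u+v≡D)))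

  module Old = TwoBlocks A a b B
  module New = TwoBlocks A u v B

  f-A : ∀ x → 1 ≤ x → x ≤ N → f x ≡ N + (a + (b + (D + rlp A x)))
  f-A x 1≤x x≤N = begin
    f x                             ≡⟨ Old.on-A x 1≤x x≤N ⟩
    a + (b + M) + rlp A x           ≡⟨ cong (λ t → a + (b + t) + rlp A x) M≡N+D ⟩
    a + (b + (N + D)) + rlp A x     ≡⟨ regroup a b N D (rlp A x) ⟩
    N + (a + (b + (D + rlp A x)))   ∎
    where
      open ≡-Reasoning
      regroup : ∀ a b N D h → a + (b + (N + D)) + h ≡ N + (a + (b + (D + h)))
      regroup = solve-∀

  f-a : ∀ p → p < a → f (N + suc p) ≡ N + (a + suc p)
  f-a p p<a = trans (Old.on-c₁ p p<a) (trans (cong (_+ suc p) (sym balanced)) (+-assoc N a (suc p)))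

  f-b : ∀ p → p < b → f (N + (a + suc p)) ≡ N + suc (p + D)
  f-b p p<b = trans (Old.on-c₂ p p<b) (trans (cong (_+ suc p) M≡N+D) (regroup N D p))
    where
      regroup : ∀ N D p → N + D + suc p ≡ N + suc (p + D)
      regroup = solve-∀

  f-B : ∀ y → 1 ≤ y → f (N + (a + (b + y))) ≡ rlp B y
  f-B = Old.on-B

  g-A : ∀ x → 1 ≤ x → x ≤ N → g x ≡ N + (D + (D + rlp A x))
  g-A x 1≤x x≤N = begin
    g x                       ≡⟨ New.on-A x 1≤x x≤N ⟩
    u + (v + M) + rlp A x     ≡⟨ cong (_+ rlp A x) (trans (sym (+-assoc u v M)) (cong₂ _+_ u+v≡D M≡N+D)) ⟩
    D + (N + D) + rlp A x     ≡⟨ regroup D N (rlp A x) ⟩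
    N + (D + (D + rlp A x))   ∎
    where
      open ≡-Reasoning
      regroup : ∀ D N h → D + (N + D) + h ≡ N + (D + (D + h))
      regroup = solve-∀

  g-mid : ∀ q → q < D → g (N + suc q) ≡ N + (D + suc ((q + v) % D))
  g-mid q q<D with below? u q
  ... | below q<u = begin
    g (N + suc q)                  ≡⟨ New.on-c₁ q q<u ⟩
    v + M + suc q                  ≡⟨ cong (λ t → v + t + suc q) M≡N+D ⟩
    v + (N + D) + suc q            ≡⟨ regroup v N D q ⟩
    N + (D + suc (q + v))          ≡⟨ cong (λ t → N + (D + suc t)) (sym (m<n⇒m%n≡m q+v<D)) ⟩
    N + (D + suc ((q + v) % D))    ∎
    where
      open ≡-Reasoning
      regroup : ∀ v N D q → v + (N + D) + suc q ≡ N + (D + suc (q + v))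
      regroup = solve-∀
      q+v<D : q + v < D
      q+v<D = subst (q + v <_) u+v≡D (+-monoˡ-< v q<u)
  ... | above r = begin
    g (N + suc (u + r))            ≡⟨ cong (λ t → g (N + t)) (sym (+-suc u r)) ⟩
    g (N + (u + suc r))            ≡⟨ New.on-c₂ r r<v ⟩
    M + suc r                      ≡⟨ trans (cong (_+ suc r) M≡N+D) (+-assoc N D (suc r)) ⟩
    N + (D + suc r)                ≡⟨ cong (λ t → N + (D + suc t)) (sym [u+r+v]%D≡r) ⟩
    N + (D + suc ((u + r + v) % D)) ∎
    where
      open ≡-Reasoning
      r<v : r < v
      r<v = +-cancelˡ-< u r v (subst (u + r <_) (sym u+v≡D) q<D)
      [u+r+v]%D≡r : (u + r + v) % D ≡ r
      [u+r+v]%D≡r = begin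
        (u + r + v) % D   ≡⟨ cong (_% D) (trans (+-exchangeʳ u r v) (+-comm (u + v) r)) ⟩
        (r + (u + v)) % D ≡⟨ cong (λ t → (r + t) % D) u+v≡D ⟩
        (r + D) % D       ≡⟨ [m+n]%n≡m%n r D ⟩
        r % D             ≡⟨ m<n⇒m%n≡m (<-≤-trans r<v (subst (v ≤_) u+v≡D (m≤n+m v u))) ⟩
        r                 ∎

  g-B : ∀ y → 1 ≤ y → g (N + (D + y)) ≡ rlp B y
  g-B y 1≤y = trans (cong (λ t → g (N + t)) (trans (cong (_+ y) (sym u+v≡D)) (+-assoc u v y))) (New.on-B y 1≤y)

  D≤a : D ≤ a
  D≤a = subst (D ≤_) (sym a≡b+D) (m≤n+m D b)

  b≤a : b ≤ a
  b≤a = subst (b ≤_) (sym a≡b+D) (m≤m+n b D)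

  1≤N+D : 1 ≤ N + D
  1≤N+D = m≤n⇒m≤o+n N (s≤s z≤n)

  rlp-B-low : ∀ y → 1 ≤ y → y ≤ M → 1 ≤ rlp B y × rlp B y ≤ N + D
  rlp-B-low y 1≤y y≤M = subst (λ m → 1 ≤ rlp B y × rlp B y ≤ m) M≡N+D (rlp-mapsInto B y 1≤y y≤M)

  data OldPlace : ℕ → Set where
    in-A : ∀ {x} → 1 ≤ x → x ≤ N → OldPlace x
    in-a : ∀ {p} → p < a → OldPlace (N + suc p)
    in-b : ∀ {p} → p < b → OldPlace (N + (a + suc p))
    in-B : ∀ {y} → 1 ≤ y → y ≤ M → OldPlace (N + (a + (b + y)))

  oldPlace : ∀ x → 1 ≤ x → x ≤ sum old → OldPlace x
  oldPlace x 1≤x x≤ with split N x 1≤x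
  ... | before p<N = in-A 1≤x p<N
  ... | after {y} 1≤y with split a y 1≤y
  ...   | before p<a = in-a p<a
  ...   | after {y′} 1≤y′ with split b y′ 1≤y′
  ...     | before p<b = in-b p<b
  ...     | after {y″} 1≤y″ =
    in-B 1≤y″ (+-cancelˡ-≤ b _ _ (+-cancelˡ-≤ a _ _ (+-cancelˡ-≤ N _ _ (subst (_ ≤_) sum-old x≤))))

  old-range : ∀ {x} → OldPlace x → 1 ≤ x × x ≤ sum old
  old-range {x} place = subst (λ n → 1 ≤ x × x ≤ n) (sym sum-old) (bounds place)
    where
      bounds : ∀ {x} → OldPlace x → 1 ≤ x × x ≤ N + (a + (b + M))
      bounds (in-A 1≤x x≤N)  = 1≤x , m≤n⇒m≤n+o _ x≤N
      bounds (in-a p<a)      = m≤n⇒m≤o+n N (s≤s z≤n) , +-monoʳ-≤ N (m≤n⇒m≤n+o _ p<a)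
      bounds (in-b p<b)      = m≤n⇒m≤o+n N (m≤n⇒m≤o+n a (s≤s z≤n)) , +-monoʳ-≤ N (+-monoʳ-≤ a (m≤n⇒m≤n+o M p<b))
      bounds (in-B 1≤y y≤M) =
        m≤n⇒m≤o+n N (m≤n⇒m≤o+n a (m≤n⇒m≤o+n b 1≤y)) , +-monoʳ-≤ N (+-monoʳ-≤ a (+-monoʳ-≤ b y≤M))

  data NewPlace : ℕ → Set where
    in-A : ∀ {x} → 1 ≤ x → x ≤ N → NewPlace x
    in-D : ∀ {q} → q < D → NewPlace (N + suc q)
    in-B : ∀ {y} → 1 ≤ y → y ≤ M → NewPlace (N + (D + y))

  newPlace : ∀ z → 1 ≤ z → z ≤ sum new → NewPlace z
  newPlace z 1≤z z≤ with split N z 1≤z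
  ... | before p<N = in-A 1≤z p<N
  ... | after {y} 1≤y with split D y 1≤y
  ...   | before q<D = in-D q<D
  ...   | after {y′} 1≤y′ = in-B 1≤y′ (+-cancelˡ-≤ D _ _ (+-cancelˡ-≤ N _ _ (subst (_ ≤_) sum-new z≤)))

  new-range : ∀ {z} → NewPlace z → 1 ≤ z × z ≤ sum new
  new-range {z} place = subst (λ m → 1 ≤ z × z ≤ m) (sym sum-new) (bounds place)
    where
      bounds : ∀ {z} → NewPlace z → 1 ≤ z × z ≤ N + (D + M)
      bounds (in-A 1≤z z≤N)  = 1≤z , m≤n⇒m≤n+o _ z≤N
      bounds (in-D q<D)      = m≤n⇒m≤o+n N (s≤s z≤n) , +-monoʳ-≤ N (m≤n⇒m≤n+o M q<D)
      bounds (in-B 1≤y y≤M) = m≤n⇒m≤o+n N (m≤n⇒m≤o+n D 1≤y) , +-monoʳ-≤ N (+-monoʳ-≤ D y≤M)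

  -- Climbing block a: from place q, every two steps add D, as long as we stay in block a.
  climb : ∀ j q → q + j * D < a → Reach f (N + suc q) (N + suc (q + j * D))
  climb zero    q _  = reach-≡ (cong (λ t → N + suc t) (sym (+-identityʳ q)))
  climb (suc j) q lt = reach-trans (climb j q p<a)
    (reach-trans (reach-step (f-a p p<a)) (reach-step (trans (f-b p p<b) (cong (λ t → N + suc t) (sym next)))))
    where
      p : ℕ
      p = q + j * D
      next : q + suc j * D ≡ p + D
      next = trans (+-exchange q D (j * D)) (+-comm D p)
      p<b : p < b
      p<b = +-cancelʳ-< D p b (subst (p + D <_) a≡b+D (subst (_< a) next lt))
      p<a : p < a
      p<a = <-≤-trans p<b b≤a

  climb-residue : ∀ p → p < a → Reach f (N + suc (p % D)) (N + suc p)
  climb-residue p p<a =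
    subst (λ t → Reach f (N + suc (p % D)) (N + suc t)) (sym p≡)
      (climb (p / D) (p % D) (subst (_< a) p≡ p<a))
    where
      p≡ : p ≡ p % D + (p / D) * D
      p≡ = m≡m%n+[m/n]*n p D

  -- The projection τ from old places to new ones: identity on A, both blocks a and b
  -- folded onto the middle region by reduction mod D, and B shifted down.
  τ : ℕ → ℕ
  τ = glue N id (glue a residue (glue b residue (λ y → N + (D + y))))
    where
      residue : ℕ → ℕ
      residue y = N + suc (pred y % D)

  τ-a : ∀ p → p < a → τ (N + suc p) ≡ N + suc (p % D)
  τ-a p p<a = trans (glue-+ N _ _ (suc p) (s≤s z≤n)) (glue-≤ a _ _ (suc p) p<a)

  τ-b : ∀ p → p < b → τ (N + (a + suc p)) ≡ N + suc (p % D)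
  τ-b p p<b = begin
    τ (N + (a + suc p)) ≡⟨ glue-+ N _ _ (a + suc p) (m≤n⇒m≤o+n a (s≤s z≤n)) ⟩
    _                   ≡⟨ glue-+ a _ _ (suc p) (s≤s z≤n) ⟩
    _                   ≡⟨ glue-≤ b _ _ (suc p) p<b ⟩
    N + suc (p % D)     ∎
    where open ≡-Reasoning

  τ-B : ∀ y → 1 ≤ y → τ (N + (a + (b + y))) ≡ N + (D + y)
  τ-B y 1≤y = begin
    τ (N + (a + (b + y))) ≡⟨ glue-+ N _ _ (a + (b + y)) (m≤n⇒m≤o+n a (m≤n⇒m≤o+n b 1≤y)) ⟩
    _                     ≡⟨ glue-+ a _ _ (b + y) (m≤n⇒m≤o+n b 1≤y) ⟩
    _                     ≡⟨ glue-+ b _ _ y 1≤y ⟩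
    N + (D + y)           ∎
    where open ≡-Reasoning

  τ-low : ∀ x → 1 ≤ x → x ≤ N + D → τ x ≡ x
  τ-low x 1≤x x≤ with split N x 1≤x
  ... | before p<N = glue-≤ N _ _ x p<N
  ... | after {suc q} _ = trans (τ-a q q<a) (cong (λ t → N + suc t) (m<n⇒m%n≡m q<D))
    where
      q<D : q < D
      q<D = +-cancelˡ-≤ N _ _ x≤
      q<a : q < a
      q<a = <-≤-trans q<D D≤a

  -- on block a, τ-steps are trivial until the last D places, which exit in one new step
  τ-step-a : ∀ p → p < a → Reach g (τ (N + suc p)) (τ (f (N + suc p)))
  τ-step-a p p<a with below? b p
  ... | below p<b = reach-≡ (begin
    τ (N + suc p)       ≡⟨ τ-a p p<a ⟩
    N + suc (p % D)     ≡⟨ τ-b p p<b ⟨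
    τ (N + (a + suc p)) ≡⟨ cong τ (f-a p p<a) ⟨
    τ (f (N + suc p))   ∎)
    where open ≡-Reasoning
  ... | above r = reach-step (begin
    g (τ (N + suc (b + r)))                 ≡⟨ cong g (τ-a (b + r) p<a) ⟩
    g (N + suc ((b + r) % D))               ≡⟨ g-mid ((b + r) % D) (m%n<n (b + r) D) ⟩
    N + (D + suc (((b + r) % D + v) % D))   ≡⟨ cong (λ t → N + (D + suc t)) [[b+r]%D+v]%D≡r ⟩
    N + (D + suc r)                         ≡⟨ τ-B (suc r) (s≤s z≤n) ⟨
    τ (N + (a + (b + suc r)))               ≡⟨ cong (λ t → τ (N + (a + t))) (+-suc b r) ⟩
    τ (N + (a + suc (b + r)))               ≡⟨ cong τ (f-a (b + r) p<a) ⟨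
    τ (f (N + suc (b + r)))                 ∎)
    where
      open ≡-Reasoning
      [[b+r]%D+v]%D≡r : ((b + r) % D + v) % D ≡ r
      [[b+r]%D+v]%D≡r = trans ([[b+r]%d+v]%d≡r%d r) (m<n⇒m%n≡m (+-cancelˡ-< b r D (subst (b + r <_) a≡b+D p<a)))

  τ-step : ∀ x → 1 ≤ x → x ≤ sum old → Reach g (τ x) (τ (f x))
  τ-step x 1≤x x≤ with oldPlace x 1≤x x≤
  ... | in-A _ x≤N = reach-step (begin
    g (τ x)                         ≡⟨ cong g (τ-low x 1≤x (m≤n⇒m≤n+o D x≤N)) ⟩
    g x                             ≡⟨ g-A x 1≤x x≤N ⟩
    N + (D + (D + rlp A x))         ≡⟨ τ-B (D + rlp A x) (s≤s z≤n) ⟨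
    τ (N + (a + (b + (D + rlp A x)))) ≡⟨ cong τ (f-A x 1≤x x≤N) ⟨
    τ (f x)                         ∎)
    where open ≡-Reasoning
  ... | in-a {p} p<a = τ-step-a p p<a
  ... | in-b {p} p<b = reach-≡ (begin
    τ (N + (a + suc p))     ≡⟨ τ-b p p<b ⟩
    N + suc (p % D)         ≡⟨ cong (λ t → N + suc t) ([m+n]%n≡m%n p D) ⟨
    N + suc ((p + D) % D)   ≡⟨ τ-a (p + D) (subst (p + D <_) (sym a≡b+D) (+-monoˡ-< D p<b)) ⟨
    τ (N + suc (p + D))     ≡⟨ cong τ (f-b p p<b) ⟨
    τ (f (N + (a + suc p))) ∎)
    where open ≡-Reasoning
  ... | in-B {y} 1≤y y≤M = reach-step (begin
    g (τ (N + (a + (b + y))))  ≡⟨ cong g (τ-B y 1≤y) ⟩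
    g (N + (D + y))            ≡⟨ g-B y 1≤y ⟩
    rlp B y                    ≡⟨ uncurry (τ-low (rlp B y)) (rlp-B-low y 1≤y y≤M) ⟨
    τ (rlp B y)                ≡⟨ cong τ (f-B y 1≤y) ⟨
    τ (f (N + (a + (b + y))))  ∎)
    where open ≡-Reasoning

  τ-image : ∀ {x z} → OldPlace x → τ x ≡ z → ∃ λ x → 1 ≤ x × x ≤ sum old × Reach g (τ x) z
  τ-image {x} place τx≡z = x , proj₁ (old-range place) , proj₂ (old-range place) , reach-≡ τx≡z

  τ-onto : ∀ z → 1 ≤ z → z ≤ sum new → ∃ λ x → 1 ≤ x × x ≤ sum old × Reach g (τ x) z
  τ-onto z 1≤z z≤ with newPlace z 1≤z z≤
  ... | in-A _ z≤N           = τ-image (in-A 1≤z z≤N) (τ-low z 1≤z (m≤n⇒m≤n+o D z≤N))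
  ... | in-D {q} q<D         = τ-image (in-a (<-≤-trans q<D D≤a)) (τ-low (N + suc q) 1≤z (+-monoʳ-≤ N q<D))
  ... | in-B {y} 1≤y y≤M     = τ-image (in-B 1≤y y≤M) (τ-B y 1≤y)

  -- The embedding ρ from new places to old ones: identity on the first N + D places
  -- (A and the entrances of block a), B shifted up past both blocks.
  ρ : ℕ → ℕ
  ρ = glue N id (glue D (N +_) (λ y → N + (a + (b + y))))

  ρ-low : ∀ z → 1 ≤ z → z ≤ N + D → ρ z ≡ z
  ρ-low z 1≤z z≤ with split N z 1≤z
  ... | before p<N = glue-≤ N _ _ z p<N
  ... | after {y} 1≤y = trans (glue-+ N _ _ y 1≤y) (glue-≤ D _ _ y (+-cancelˡ-≤ N _ _ z≤))

  ρ-entrance : ∀ q → q < D → ρ (N + suc q) ≡ N + suc q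
  ρ-entrance q q<D = ρ-low (N + suc q) (m≤n⇒m≤o+n N (s≤s z≤n)) (+-monoʳ-≤ N q<D)

  ρ-B : ∀ y → 1 ≤ y → ρ (N + (D + y)) ≡ N + (a + (b + y))
  ρ-B y 1≤y = trans (glue-+ N _ _ (D + y) (s≤s z≤n)) (glue-+ D _ _ y 1≤y)

  -- a middle place q climbs block a up to its exit b + ((q + v) mod D), which the old
  -- permutation sends to the B-place the new one sends q to
  ρ-step-mid : ∀ q → q < D → Reach f (ρ (N + suc q)) (ρ (g (N + suc q)))
  ρ-step-mid q q<D = reach-trans (reach-≡ enter) (reach-trans (climb-residue (b + e) b+e<a) (reach-step leave))
    where
      open ≡-Reasoning
      e : ℕ
      e = (q + v) % D
      b+e<a : b + e < a
      b+e<a = subst (b + e <_) (sym a≡b+D) (+-monoʳ-< b (m%n<n (q + v) D))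
      enter : ρ (N + suc q) ≡ N + suc ((b + e) % D)
      enter = begin
        ρ (N + suc q)          ≡⟨ ρ-entrance q q<D ⟩
        N + suc q              ≡⟨ cong (λ t → N + suc t) (trans ([b+[r+v]%d]%d≡r%d q) (m<n⇒m%n≡m q<D)) ⟨
        N + suc ((b + e) % D)  ∎
      leave : f (N + suc (b + e)) ≡ ρ (g (N + suc q))
      leave = begin
        f (N + suc (b + e))    ≡⟨ f-a (b + e) b+e<a ⟩
        N + (a + suc (b + e))  ≡⟨ cong (λ t → N + (a + t)) (+-suc b e) ⟨
        N + (a + (b + suc e))  ≡⟨ ρ-B (suc e) (s≤s z≤n) ⟨
        ρ (N + (D + suc e))    ≡⟨ cong ρ (g-mid q q<D) ⟨
        ρ (g (N + suc q))      ∎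

  ρ-step : ∀ z → 1 ≤ z → z ≤ sum new → Reach f (ρ z) (ρ (g z))
  ρ-step z 1≤z z≤ with newPlace z 1≤z z≤
  ... | in-A _ z≤N = reach-step (begin
    f (ρ z)                          ≡⟨ cong f (ρ-low z 1≤z (m≤n⇒m≤n+o D z≤N)) ⟩
    f z                              ≡⟨ f-A z 1≤z z≤N ⟩
    N + (a + (b + (D + rlp A z)))    ≡⟨ ρ-B (D + rlp A z) (s≤s z≤n) ⟨
    ρ (N + (D + (D + rlp A z)))      ≡⟨ cong ρ (g-A z 1≤z z≤N) ⟨
    ρ (g z)                          ∎)
    where open ≡-Reasoning
  ... | in-D {q} q<D = ρ-step-mid q q<D
  ... | in-B {y} 1≤y y≤M = reach-step (begin
    f (ρ (N + (D + y)))        ≡⟨ cong f (ρ-B y 1≤y) ⟩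
    f (N + (a + (b + y)))      ≡⟨ f-B y 1≤y ⟩
    rlp B y                    ≡⟨ uncurry (ρ-low (rlp B y)) (rlp-B-low y 1≤y y≤M) ⟨
    ρ (rlp B y)                ≡⟨ cong ρ (g-B y 1≤y) ⟨
    ρ (g (N + (D + y)))        ∎)
    where open ≡-Reasoning

  ρ-from : ∀ {z x} → NewPlace z → Reach f (ρ z) x → ∃ λ z → 1 ≤ z × z ≤ sum new × Reach f (ρ z) x
  ρ-from {z} place ρz⇝x = z , proj₁ (new-range place) , proj₂ (new-range place) , ρz⇝x

  ρ-residue : ∀ p → Reach f (ρ (N + suc (p % D))) (N + suc (p % D))
  ρ-residue p = reach-≡ (ρ-entrance (p % D) (m%n<n p D))

  ρ-onto : ∀ x → 1 ≤ x → x ≤ sum old → ∃ λ z → 1 ≤ z × z ≤ sum new × Reach f (ρ z) x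
  ρ-onto x 1≤x x≤ with oldPlace x 1≤x x≤
  ... | in-A _ x≤N       = ρ-from (in-A 1≤x x≤N) (reach-≡ (ρ-low x 1≤x (m≤n⇒m≤n+o D x≤N)))
  ... | in-a {p} p<a     = ρ-from (in-D (m%n<n p D)) (reach-trans (ρ-residue p) (climb-residue p p<a))
  ... | in-b {p} p<b     = ρ-from (in-D (m%n<n p D))
    (reach-trans (ρ-residue p) (reach-trans (climb-residue p p<a) (reach-step (f-a p p<a))))
    where
      p<a : p < a
      p<a = <-≤-trans p<b b≤a
  ... | in-B {y} 1≤y y≤M = ρ-from (in-B 1≤y y≤M) (reach-≡ (ρ-B y 1≤y))

  cyclic⇔ : Cyclic old ⇔ Cyclic new
  cyclic⇔ = mk⇔
    (covers-transfer f g τ (sum old) (sum new) (rlp-mapsInto old) (τ-low 1 ≤-refl 1≤N+D) τ-step τ-onto)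
    (covers-transfer g f ρ (sum new) (sum old) (rlp-mapsInto new) (ρ-low 1 ≤-refl 1≤N+D) ρ-step ρ-onto)

reverse-middle : ∀ (A : List ℕ) x y B → reverse (A ++ x ∷ y ∷ B) ≡ reverse B ++ y ∷ x ∷ reverse A
reverse-middle A x y B = begin
  reverse (A ++ (x ∷ y ∷ []) ++ B)          ≡⟨ reverse-++ A ((x ∷ y ∷ []) ++ B) ⟩
  reverse ((x ∷ y ∷ []) ++ B) ++ reverse A  ≡⟨ cong (_++ reverse A) (reverse-++ (x ∷ y ∷ []) B) ⟩
  (reverse B ++ y ∷ x ∷ []) ++ reverse A    ≡⟨ ++-assoc (reverse B) (y ∷ x ∷ []) (reverse A) ⟩
  reverse B ++ y ∷ x ∷ reverse A            ∎
  where open ≡-Reasoning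

balance-reverse : ∀ A B x y → sum A + x ≡ y + sum B → sum (reverse B) + y ≡ x + sum (reverse A)
balance-reverse A B x y balanced = begin
  sum (reverse B) + y   ≡⟨ cong (_+ y) (sum-reverse B) ⟩
  sum B + y             ≡⟨ +-comm (sum B) y ⟩
  y + sum B             ≡⟨ balanced ⟨
  sum A + x             ≡⟨ +-comm (sum A) x ⟩
  x + sum A             ≡⟨ cong (x +_) (sum-reverse A) ⟨
  x + sum (reverse A)   ∎
  where open ≡-Reasoning

-- Lemma 3.2 when aₖ > bₘ: the reduction is Greater.cyclic⇔ up to omitting a zero part.
reduce-greater : ∀ A B b d → sum A + suc (b + d) ≡ b + sum B →
  Cyclic (A ++ suc (b + d) ∷ b ∷ B) ⇔
  Cyclic (A ++ opt (suc (b + d) % suc d) ++ (suc d ∸ (suc (b + d) % suc d)) ∷ B)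
reduce-greater A B b d balanced =
  ⇔-sym (cyclic-opt A _ _) ⇔-∘ Greater.cyclic⇔ A B (suc (b + d)) b d (sym (+-suc b d)) balanced

-- Lemma 3.2 when aₖ < bₘ: reversing the composition exchanges the two halves and the two
-- parts at the bar, turning the reduction into the case aₖ > bₘ.
reduce-less : ∀ A B a d → sum A + a ≡ suc (a + d) + sum B →
  Cyclic (A ++ a ∷ suc (a + d) ∷ B) ⇔ Cyclic (A ++ (suc d ∸ (a % suc d)) ∷ opt (a % suc d) ++ B)
reduce-less A B a d balanced = begin
  Cyclic (A ++ a ∷ b ∷ B)                                       ≈⟨ cyclic⇔cyclic-reverse (A ++ a ∷ b ∷ B) ⟩
  Cyclic (reverse (A ++ a ∷ b ∷ B))                             ≡⟨ cong Cyclic (reverse-middle A a b B) ⟩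
  Cyclic (reverse B ++ b ∷ a ∷ reverse A)                       ≈⟨ Greater.cyclic⇔ (reverse B) (reverse A) b a d (sym (+-suc a d)) balanced′ ⟩
  Cyclic (reverse B ++ b % D ∷ (D ∸ b % D) ∷ reverse A)         ≡⟨ cong (λ t → Cyclic (reverse B ++ t ∷ (D ∸ t) ∷ reverse A)) b%D≡u ⟩
  Cyclic (reverse B ++ u ∷ v ∷ reverse A)                       ≡⟨ cong Cyclic (reverse-middle A v u B) ⟨
  Cyclic (reverse (A ++ v ∷ u ∷ B))                             ≈⟨ cyclic⇔cyclic-reverse (A ++ v ∷ u ∷ B) ⟨
  Cyclic (A ++ v ∷ u ∷ B)                                       ≡⟨ cong Cyclic (++-assoc A [ v ] (u ∷ B)) ⟨
  Cyclic ((A ++ [ v ]) ++ u ∷ B)                                ≈⟨ cyclic-opt (A ++ [ v ]) u B ⟨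
  Cyclic ((A ++ [ v ]) ++ opt u ++ B)                           ≡⟨ cong Cyclic (++-assoc A [ v ] (opt u ++ B)) ⟩
  Cyclic (A ++ v ∷ opt u ++ B)                                  ∎
  where
    open SetoidReasoning (⇔-setoid 0ℓ)
    D b u v : ℕ
    D = suc d
    b = suc (a + d)
    u = a % D
    v = D ∸ u
    balanced′ : sum (reverse B) + b ≡ a + sum (reverse A)
    balanced′ = balance-reverse A B a b balanced
    b%D≡u : b % D ≡ u
    b%D≡u = trans (cong (_% D) (sym (+-suc a d))) ([m+n]%n≡m%n a D)

-- The theorem: split on the comparison of aₖ and bₘ that red performs.
lemma3p2 : (A' : List ℕ) (ak bm : ℕ) (B' : List ℕ) →
    All (0 <_) (A' ++ ak ∷ bm ∷ B') →
    sum A' + ak ≡ bm + sum B' →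
    ak ≢ bm →
    Cyclic (A' ++ ak ∷ bm ∷ B') ⇔ Cyclic (red A' ak bm B')
lemma3p2 A' ak bm B' _ balanced ak≢bm with compare ak bm
... | less .ak d    = reduce-less A' B' ak d balanced
... | equal .ak     = contradiction refl ak≢bm
... | greater .bm d = reduce-greater A' B' bm d balanced
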